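{- Let $n\geq 2$. The logic $\mathrm{S5WD}_n$ is sound and complete for $\mathcal{L}_n$ with respect to each of the following classes: (1) the class of full systems; (2) the class of hypercube systems; (3) the class of EDI frames; (4) the class of ED frames. That is, for each of these classes $\mathcal{C}$ and every formula $\varphi\in\mathcal{L}_n$: $\varphi$ is a theorem of $\mathrm{S5WD}_n$ if and only if $\varphi$ is valid on every member of $\mathcal{C}$ (for a system $S$ of global states, "valid on $S$" means valid on the frame $F(S)$).
   Context: Fix a set of propositional atoms and agents $A=\{1,\dots,n\}$. The language $\mathcal{L}_n$ is given by $\varphi ::= p \mid \neg\varphi \mid \varphi\wedge\varphi \mid \Box_i\varphi$ ($p$ an atom, $i\in A$); $\Diamond_i\varphi$ abbreviates $\neg\Box_i\neg\varphi$. A frame is $F=(W,R_1,\dots,R_n)$ with $W$ nonempty and each $R_i\subseteq W\times W$; a model is $(F,\pi)$ with $\pi:W\to 2^{\mathrm{Atoms}}$; satisfaction is standard ($\Box_i\psi$ holds at $w$ iff $\psi$ holds at every $w'$ with $wR_iw'$). A formula is valid on a frame if it holds at every world under every $\pi$. An equivalence frame is one where every $R_i$ (written $\sim_i$) is an equivalence relation. A frame is directed (D) if for any $w_1,\dots,w_n\in W$ there is $\overline{w}\in W$ with $w_i\sim_i\overline{w}$ for all $i$; it has the identity intersection property (I) if $\bigcap_{i\in A}\sim_i$ is the identity relation on $W$. ED frames are directed equivalence frames; EDI frames are directed equivalence frames with property I. A system of global states is a nonempty subset $S\subseteq L_e\times L_1\times\dots\times L_n$ where $L_e,L_1,\dots,L_n$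 are nonempty sets; $F(S)$ is the frame $(S,\sim_1,\dots,\sim_n)$ with $(l_e,l_1,\dots,l_n)\sim_i(l'_e,l'_1,\dots,l'_n)$ iff $l_i=l'_i$. $S$ is full if for every $\langle l_1,\dots,l_n\rangle\in L_1\times\dots\times L_n$ there is $s\in L_e$ with $\langle s,l_1,\dots,l_n\rangle\in S$. A hypercube system is a full product $L_e\times L_1\times\dots\times L_n$ with $L_e$ a singleton and each $L_i$ nonempty. Write $S\varphi$ for $\bigvee_{i=1}^n\Diamond_i\varphi$. A formula is $i$-local if it is a Boolean combination of formulae of the form $\Box_i\psi$. $\mathrm{S5}_n$ is the logic with all propositional tautologies, and for each $i$ the axioms $\Box_i(p\to q)\to(\Box_ip\to\Box_iq)$, $\Box_ip\to p$, $\Box_ip\to\Box_i\Box_ip$, $\neg\Box_i\neg p\to\Box_i\neg\Box_i\neg p$, closed under modus ponens, necessitation and uniform substitution. $\mathrm{S5WD}_n$ is $\mathrm{S5}_n$ plus the axiom schema (WD): $\left(\bigwedge_{i=1}^n S\varphi_i\right)\to SS\left(\bigwedge_{i=1}^n\varphi_i\right)$, for all formulae $\varphi_1,\dots,\varphi_n$ with each $\varphi_i$ $i$-local. -}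

module Defs where

open import Level using (0ℓ)
open import Data.Nat using (ℕ; zero; suc)
open import Data.Fin using (Fin; zero; suc)
open import Data.Bool using (Bool; true; false; not; _∧_)
open import Data.Product using (Σ; _×_; _,_; proj₁; proj₂)
open import Data.Empty using (⊥)
open import Relation.Nullary using (¬_)
open import Relation.Binary.PropositionalEquality using (_≡_)
open import Relation.Binary.Structures using (IsEquivalence)
open import Function.Bundles using (_⇔_)

Atom : Set
Atom = ℕ

data Form (n : ℕ) : Set where
  atom : Atom → Form n
  ~_   : Form n → Form n
  _∧'_ : Form n → Form n → Form n
  □    : Fin n → Form n → Form n

infix 8 ~_
infixr 6 _∧'_

module _ {n : ℕ} where

  infixr 4 _⇒_
  infixr 5 _∨'_

  _⇒_ : Form n → Form n → Form n
  φ ⇒ ψ = ~ (φ ∧' ~ ψ)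

  _∨'_ : Form n → Form n → Form n
  φ ∨' ψ = ~ (~ φ ∧' ~ ψ)

  ◇ : Fin n → Form n → Form n
  ◇ i φ = ~ □ i (~ φ)

  ⊥f : Form n
  ⊥f = atom 0 ∧' ~ atom 0

  ⊤f : Form n
  ⊤f = ~ ⊥f

  ⋁ : ∀ {m} → (Fin m → Form n) → Form n
  ⋁ {zero}        f = ⊥f
  ⋁ {suc zero}    f = f zero
  ⋁ {suc (suc m)} f = f zero ∨' ⋁ (λ k → f (suc k))

  ⋀ : ∀ {m} → (Fin m → Form n) → Form n
  ⋀ {zero}        f = ⊤f
  ⋀ {suc zero}    f = f zero
  ⋀ {suc (suc m)} f = f zero ∧' ⋀ (λ k → f (suc k))

  𝕊 : Form n → Form n
  𝕊 φ = ⋁ (λ i → ◇ i φ)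

  data Local (i : Fin n) : Form n → Set where
    box : ∀ ψ → Local i (□ i ψ)
    neg : ∀ {φ} → Local i φ → Local i (~ φ)
    conj : ∀ {φ ψ} → Local i φ → Local i ψ → Local i (φ ∧' ψ)

  -- Propositional tautologies: formulas true under every Boolean
  -- valuation that treats atoms and boxed formulas as propositional
  -- variables (= substitution instances of propositional tautologies).
  tv : (Form n → Bool) → Form n → Bool
  tv v (atom p) = v (atom p)
  tv v (~ φ)    = not (tv v φ)
  tv v (φ ∧' ψ) = tv v φ ∧ tv v ψ
  tv v (□ i φ)  = v (□ i φ)

  Tautology : Form n → Set
  Tautology φ = (v : Form n → Bool) → tv v φ ≡ true

  subst : (Atom → Form n) → Form n → Form n
  subst σ (atom p) = σ p
  subst σ (~ φ)    = ~ subst σ φ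
  subst σ (φ ∧' ψ) = subst σ φ ∧' subst σ ψ
  subst σ (□ i φ)  = □ i (subst σ φ)

  p q : Form n
  p = atom 0
  q = atom 1

  data S5WD : Form n → Set where
    taut : ∀ {φ} → Tautology φ → S5WD φ
    axK  : ∀ i → S5WD (□ i (p ⇒ q) ⇒ (□ i p ⇒ □ i q))
    axT  : ∀ i → S5WD (□ i p ⇒ p)
    ax4  : ∀ i → S5WD (□ i p ⇒ □ i (□ i p))
    ax5  : ∀ i → S5WD (~ □ i (~ p) ⇒ □ i (~ □ i (~ p)))
    axWD : (φs : Fin n → Form n) → (∀ i → Local i (φs i)) →
           S5WD (⋀ (λ i → 𝕊 (φs i)) ⇒ 𝕊 (𝕊 (⋀ φs)))
    mp   : ∀ {φ ψ} → S5WD (φ ⇒ ψ) → S5WD φ → S5WD ψ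
    nec  : ∀ {φ} i → S5WD φ → S5WD (□ i φ)
    us   : ∀ {φ} (σ : Atom → Form n) → S5WD φ → S5WD (subst σ φ)

record Frame (n : ℕ) : Set₁ where
  field
    W   : Set
    w₀  : W                        -- W is nonempty
    R   : Fin n → W → W → Set

module _ {n : ℕ} (F : Frame n) where
  open Frame F

  Valuation : Set
  Valuation = W → Atom → Bool

  sat : Valuation → W → Form n → Set
  sat π w (atom a) = π w a ≡ true
  sat π w (~ φ)    = ¬ sat π w φ
  sat π w (φ ∧' ψ) = sat π w φ × sat π w ψ
  sat π w (□ i φ)  = ∀ w' → R i w w' → sat π w' φ

  ValidOn : Form n → Set
  ValidOn φ = (π : Valuation) (w : W) → sat π w φ

  IsEquivFrame : Set
  IsEquivFrame = ∀ i → IsEquivalence (R i)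

  Directed : Set
  Directed = (ws : Fin n → W) → Σ W (λ w̄ → ∀ i → R i (ws i) w̄)

  IdIntersection : Set
  IdIntersection = ∀ w w' → ((∀ i → R i w w') ⇔ (w ≡ w'))

  IsED : Set
  IsED = IsEquivFrame × Directed

  IsEDI : Set
  IsEDI = IsEquivFrame × Directed × IdIntersection

record System (n : ℕ) : Set₁ where
  field
    Le : Set
    L  : Fin n → Set
    S  : (Le × ((i : Fin n) → L i)) → Bool
    nonempty : Σ (Le × ((i : Fin n) → L i)) (λ g → S g ≡ true)

  GState : Set
  GState = Σ (Le × ((i : Fin n) → L i)) (λ g → S g ≡ true)

module _ {n : ℕ} (Sys : System n) where
  open System Sys

  frameOf : Frame n
  frameOf = record
    { W  = GState
    ; w₀ = nonempty
    ; R  = λ i g g' → proj₂ (proj₁ g) i ≡ proj₂ (proj₁ g') i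
    }

  IsFull : Set
  IsFull = (ls : (i : Fin n) → L i) → Σ Le (λ s → S (s , ls) ≡ true)

  IsHypercube : Set
  IsHypercube = Σ Le (λ e → ∀ e' → e' ≡ e)
              × ((i : Fin n) → L i)
              × (∀ g → S g ≡ true)

SoundCompleteFrames : (n : ℕ) → (Frame n → Set) → Set₁
SoundCompleteFrames n C =
  (φ : Form n) → S5WD φ ⇔ ((F : Frame n) → C F → ValidOn F φ)

SoundCompleteSystems : (n : ℕ) → (System n → Set) → Set₁
SoundCompleteSystems n C =
  (φ : Form n) → S5WD φ ⇔ ((Sys : System n) → C Sys → ValidOn (frameOf Sys) φ)

{-# OPTIONS --safe #-}
-- Soundness. Given witnesses uᵢ of the 𝕊 φᵢ at w, directedness yields x̄ with uᵢ ~ᵢ x̄ for all i;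
-- each φᵢ is i-local, hence still true at x̄, and x̄ is reached from w in two steps through u₀.
--
-- Relate maximal consistent sets by Γ ~ᵢ Δ when they contain the same
-- □ᵢ-formulas. WD makes the i-local members of neighbours Dᵢ of a common Γ jointly
-- consistent, so the Dᵢ have a common successor Θ with Dᵢ ~ᵢ Θ. Consequently two-step
-- reachability is an equivalence and each of its classes is directed. Given ⊬ φ, take Γ₀ ∋ ¬φ
-- and build a hypercube whose local states are pairs (Θ, b) with Θ in the class of Γ₀ and b a
-- bit. A global state denotes the theory of a designated coordinate, selected by the bits of
-- coordinates 0 and 1, when that theory is ~ⱼ-related to every coordinate j, and otherwise a
-- common successor of its coordinates. The bits let every ◇ᵢ-witness be realised by a global
-- state whose designated coordinate is not i (this is where n ≥ 2 is needed), which gives the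
-- truth lemma. The same model laid out on vectors is an EDI frame. Since hypercube systems are
-- full and full systems and EDI frames are ED, soundness for ED frames and completeness for
-- hypercubes and for EDI frames cover all four classes.

module Submission where

open import Defs
open import Level using (0ℓ)
open import Axiom.ExcludedMiddle using (ExcludedMiddle)
open import Data.Bool using (Bool; true; false; not; T; if_then_else_; _xor_)
open import Data.Bool.Properties using (T-≡; T-∧; T?)
open import Data.Empty using (⊥; ⊥-elim)
open import Data.Fin using (Fin; zero; suc)
open import Data.Fin.Properties using (_≟_)
open import Data.Vec.Functional using (updateAt)
open import Data.Vec.Functional.Properties using (updateAt-updates; updateAt-minimal)
open import Data.List using (List; []; _∷_; _++_; map; foldl; allFin; cartesianProductWith)
open import Data.List.Membership.Propositional using (_∈_)
open import Data.List.Membership.Propositional.Properties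
  using (∈-map⁺; ∈-++⁺ˡ; ∈-++⁺ʳ; ∈-allFin; ∈-cartesianProductWith⁺)
open import Data.List.Relation.Binary.Subset.Propositional using (_⊆_)
open import Data.List.Relation.Binary.Subset.Propositional.Properties using (xs⊆xs++ys; xs⊆ys++xs)
import Data.List.Relation.Binary.Subset.Propositional.Properties as ⊆
open import Data.List.Relation.Unary.All as All using (All; []; _∷_)
import Data.List.Relation.Unary.All.Properties as All
open import Data.List.Relation.Unary.Any using (here; there)
open import Data.Nat using (ℕ; zero; suc; _≤_; _≤′_; ≤′-refl; ≤′-step; _⊔_; z≤n; s≤s)
open import Data.Nat.Properties using (≤⇒≤′; m≤m⊔n; m≤n⊔m)
open import Data.Product using (Σ; ∃; ∃₂; _×_; _,_; proj₁; proj₂)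
import Data.Product as Product
open import Data.Product.Function.NonDependent.Propositional using (_×-⇔_)
open import Data.Sum using (_⊎_; inj₁; inj₂)
import Data.Sum as Sum
open import Data.Unit using (⊤; tt)
open import Data.Vec using (Vec; lookup; tabulate; replicate)
open import Data.Vec.Properties using (lookup∘tabulate; tabulate∘lookup; tabulate-cong)
open import Function using (_∘_; id; const)
open import Function.Bundles using (_⇔_; mk⇔; Equivalence)
import Function.Properties.Equivalence as ⇔
open import Function.Related.TypeIsomorphisms using (¬-cong-⇔)
open import Relation.Nullary using (¬_; Dec; yes; no)
open import Relation.Nullary.Decidable using (isYes; toWitness; fromWitness; decidable-stable)
open import Relation.Binary.PropositionalEquality using (_≡_; _≢_; refl; sym)
import Relation.Binary.PropositionalEquality as ≡
open import Relation.Binary.Structures using (IsEquivalence)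

chain-⊆ : ∀ {A : Set} (xs : ℕ → List A) → (∀ k → xs k ⊆ xs (suc k)) →
          ∀ {k k'} → k ≤ k' → xs k ⊆ xs k'
chain-⊆ xs step k≤k' = go (≤⇒≤′ k≤k')
  where
  go : ∀ {k k'} → k ≤′ k' → xs k ⊆ xs k'
  go ≤′-refl            = id
  go (≤′-step k≤′k') = step _ ∘ go k≤′k'

T-not : ∀ {b} → T (not b) ⇔ (¬ T b)
T-not {false} = mk⇔ (λ _ ()) (λ _ → tt)
T-not {true}  = mk⇔ (λ ()) (λ ¬t → ¬t tt)

module _ {n : ℕ} where

  infix 3.5 ⊢_
  ⊢_ : Form n → Set
  ⊢_ = S5WD

  infix 3.5 _⊨_
  record _⊨_ (v : Form n → Bool) (φ : Form n) : Set where
    constructor ⟨_⟩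
    field holds : T (tv v φ)
  open _⊨_ public

  module _ {v : Form n → Bool} where

    ⊨-dec : ∀ φ → Dec (v ⊨ φ)
    ⊨-dec φ with T? (tv v φ)
    ... | yes t = yes ⟨ t ⟩
    ... | no ¬t = no (¬t ∘ holds)

    ⊨-~⁺ : ∀ {φ} → ¬ v ⊨ φ → v ⊨ ~ φ
    ⊨-~⁺ ¬s = ⟨ Equivalence.from T-not (¬s ∘ ⟨_⟩) ⟩

    ⊨-~⁻ : ∀ {φ} → v ⊨ ~ φ → ¬ v ⊨ φ
    ⊨-~⁻ ⟨ t ⟩ ⟨ s ⟩ = Equivalence.to T-not t s

    ⊨-~~⁻ : ∀ {φ} → v ⊨ ~ ~ φ → v ⊨ φ
    ⊨-~~⁻ {φ} s with ⊨-dec φ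
    ... | yes sφ = sφ
    ... | no ¬sφ = ⊥-elim (⊨-~⁻ s (⊨-~⁺ ¬sφ))

    ⊨-∧⁺ : ∀ {φ ψ} → v ⊨ φ → v ⊨ ψ → v ⊨ φ ∧' ψ
    ⊨-∧⁺ {φ} {ψ} ⟨ s ⟩ ⟨ t ⟩ = ⟨ Equivalence.from (T-∧ {tv v φ} {tv v ψ}) (s , t) ⟩

    ⊨-∧⁻ˡ : ∀ {φ ψ} → v ⊨ φ ∧' ψ → v ⊨ φ
    ⊨-∧⁻ˡ {φ} {ψ} ⟨ s ⟩ = ⟨ proj₁ (Equivalence.to (T-∧ {tv v φ} {tv v ψ}) s) ⟩

    ⊨-∧⁻ʳ : ∀ {φ ψ} → v ⊨ φ ∧' ψ → v ⊨ ψ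
    ⊨-∧⁻ʳ {φ} {ψ} ⟨ s ⟩ = ⟨ proj₂ (Equivalence.to (T-∧ {tv v φ} {tv v ψ}) s) ⟩

    ⊨-⇒⁺ : ∀ {φ ψ} → (v ⊨ φ → v ⊨ ψ) → v ⊨ φ ⇒ ψ
    ⊨-⇒⁺ f = ⊨-~⁺ (λ s → ⊨-~⁻ (⊨-∧⁻ʳ s) (f (⊨-∧⁻ˡ s)))

    ⊨-⇒⁻ : ∀ {φ ψ} → v ⊨ φ ⇒ ψ → v ⊨ φ → v ⊨ ψ
    ⊨-⇒⁻ {ψ = ψ} s sφ with ⊨-dec ψ
    ... | yes sψ = sψ
    ... | no ¬sψ = ⊥-elim (⊨-~⁻ s (⊨-∧⁺ sφ (⊨-~⁺ ¬sψ)))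

    ⊨-⊤ : v ⊨ ⊤f
    ⊨-⊤ = ⊨-~⁺ (λ s → ⊨-~⁻ (⊨-∧⁻ʳ s) (⊨-∧⁻ˡ s))

    ⊨-⋀⁻ : ∀ {k} (f : Fin k → Form n) → v ⊨ ⋀ f → ∀ i → v ⊨ f i
    ⊨-⋀⁻ {suc zero}    f s zero    = s
    ⊨-⋀⁻ {suc (suc k)} f s zero    = ⊨-∧⁻ˡ s
    ⊨-⋀⁻ {suc (suc k)} f s (suc i) = ⊨-⋀⁻ (f ∘ suc) (⊨-∧⁻ʳ s) i

    ⊨-⋁⁺ : ∀ {k} (f : Fin k → Form n) i → v ⊨ f i → v ⊨ ⋁ f
    ⊨-⋁⁺ {suc zero}    f zero    s = s
    ⊨-⋁⁺ {suc (suc k)} f zero    s = ⊨-~⁺ (λ t → ⊨-~⁻ (⊨-∧⁻ˡ t) s)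
    ⊨-⋁⁺ {suc (suc k)} f (suc i) s = ⊨-~⁺ (λ t → ⊨-~⁻ (⊨-∧⁻ʳ t) (⊨-⋁⁺ (f ∘ suc) i s))

  ⊢-taut : ∀ {φ} → (∀ v → v ⊨ φ) → ⊢ φ
  ⊢-taut h = taut (λ v → Equivalence.to T-≡ (holds (h v)))

  ⊢-taut⇒ : ∀ {φ ψ} → ⊢ φ → (∀ v → v ⊨ φ → v ⊨ ψ) → ⊢ ψ
  ⊢-taut⇒ ⊢φ h = mp (⊢-taut (λ v → ⊨-⇒⁺ (h v))) ⊢φ

  ⊢-taut⇒₂ : ∀ {φ ψ χ} → ⊢ φ → ⊢ ψ → (∀ v → v ⊨ φ → v ⊨ ψ → v ⊨ χ) → ⊢ χ
  ⊢-taut⇒₂ ⊢φ ⊢ψ h = mp (⊢-taut⇒ ⊢φ (λ v sφ → ⊨-⇒⁺ (h v sφ))) ⊢ψ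

  ⋀ₗ : List (Form n) → Form n
  ⋀ₗ []      = ⊤f
  ⋀ₗ (φ ∷ l) = φ ∧' ⋀ₗ l

  module _ {v : Form n → Bool} where

    ⊨-⋀ₗ⁺ : ∀ {l} → All (v ⊨_) l → v ⊨ ⋀ₗ l
    ⊨-⋀ₗ⁺ []       = ⊨-⊤
    ⊨-⋀ₗ⁺ (s ∷ ss) = ⊨-∧⁺ s (⊨-⋀ₗ⁺ ss)

    ⊨-⋀ₗ⁻ : ∀ l → v ⊨ ⋀ₗ l → All (v ⊨_) l
    ⊨-⋀ₗ⁻ []      _ = []
    ⊨-⋀ₗ⁻ (φ ∷ l) s = ⊨-∧⁻ˡ s ∷ ⊨-⋀ₗ⁻ l (⊨-∧⁻ʳ s)

    ⊨-⋀ₗ-mono : ∀ {l l'} → l ⊆ l' → v ⊨ ⋀ₗ l' → v ⊨ ⋀ₗ l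
    ⊨-⋀ₗ-mono {l' = l'} l⊆l' s = ⊨-⋀ₗ⁺ (All.tabulate (All.lookup (⊨-⋀ₗ⁻ l' s) ∘ l⊆l'))

  Consistent : (Form n → Set) → Set
  Consistent X = ∀ l → All X l → ¬ ⊢ ~ ⋀ₗ l

  record MCS : Set where
    field
      mem        : Form n → Bool
      complete   : ∀ φ → T (mem φ) ⊎ T (mem (~ φ))
      consistent : Consistent (T ∘ mem)

  infix 3.5 _∋_
  record _∋_ (Γ : MCS) (φ : Form n) : Set where
    constructor ⟪_⟫
    field member : T (MCS.mem Γ φ)
  open _∋_ public

  module _ {Γ : MCS} where
    open MCS Γ

    ∋-⊢closed : ∀ {l ψ} → All (Γ ∋_) l → ⊢ ⋀ₗ l ⇒ ψ → Γ ∋ ψ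
    ∋-⊢closed {l} {ψ} ms ⊢l⇒ψ with complete ψ
    ... | inj₁ m  = ⟪ m ⟫
    ... | inj₂ m~ = ⊥-elim (consistent (~ ψ ∷ l) (m~ ∷ All.map member ms)
                      (⊢-taut⇒ ⊢l⇒ψ (λ v s → ⊨-~⁺ (λ t → ⊨-~⁻ (⊨-∧⁻ˡ t) (⊨-⇒⁻ s (⊨-∧⁻ʳ t))))))

    ∋-closed : ∀ {l ψ} → All (Γ ∋_) l → (∀ v → v ⊨ ⋀ₗ l → v ⊨ ψ) → Γ ∋ ψ
    ∋-closed ms h = ∋-⊢closed ms (⊢-taut (λ v → ⊨-⇒⁺ (h v)))

    ∋-⊢ : ∀ {ψ} → ⊢ ψ → Γ ∋ ψ
    ∋-⊢ ⊢ψ = ∋-⊢closed [] (⊢-taut⇒ ⊢ψ (λ v s → ⊨-⇒⁺ (λ _ → s)))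

    ∋-mp : ∀ {φ ψ} → Γ ∋ φ ⇒ ψ → Γ ∋ φ → Γ ∋ ψ
    ∋-mp m mφ = ∋-closed (m ∷ mφ ∷ []) (λ v s → ⊨-⇒⁻ (⊨-∧⁻ˡ s) (⊨-∧⁻ˡ (⊨-∧⁻ʳ s)))

    ∋-⊢mp : ∀ {φ ψ} → ⊢ φ ⇒ ψ → Γ ∋ φ → Γ ∋ ψ
    ∋-⊢mp = ∋-mp ∘ ∋-⊢

    ∋-taut : ∀ {φ ψ} → (∀ v → v ⊨ φ → v ⊨ ψ) → Γ ∋ φ → Γ ∋ ψ
    ∋-taut h mφ = ∋-closed (mφ ∷ []) (λ v s → h v (⊨-∧⁻ˡ s))

    ∋-~⁻ : ∀ {φ} → Γ ∋ ~ φ → ¬ Γ ∋ φ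
    ∋-~⁻ m~ mφ = consistent (_ ∷ _ ∷ []) (member mφ ∷ member m~ ∷ [])
                   (⊢-taut (λ v → ⊨-~⁺ (λ s → ⊨-~⁻ (⊨-∧⁻ˡ (⊨-∧⁻ʳ s)) (⊨-∧⁻ˡ s))))

    ∋-~⁺ : ∀ {φ} → ¬ Γ ∋ φ → Γ ∋ ~ φ
    ∋-~⁺ {φ} ∌φ with complete φ
    ... | inj₁ m  = ⊥-elim (∌φ ⟪ m ⟫)
    ... | inj₂ m~ = ⟪ m~ ⟫

    ∋-∧⁺ : ∀ {φ ψ} → Γ ∋ φ → Γ ∋ ψ → Γ ∋ φ ∧' ψ
    ∋-∧⁺ mφ mψ = ∋-closed (mφ ∷ mψ ∷ []) (λ v s → ⊨-∧⁺ (⊨-∧⁻ˡ s) (⊨-∧⁻ˡ (⊨-∧⁻ʳ s)))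

    ∋-∧⁻ˡ : ∀ {φ ψ} → Γ ∋ φ ∧' ψ → Γ ∋ φ
    ∋-∧⁻ˡ = ∋-taut (λ v → ⊨-∧⁻ˡ)

    ∋-∧⁻ʳ : ∀ {φ ψ} → Γ ∋ φ ∧' ψ → Γ ∋ ψ
    ∋-∧⁻ʳ = ∋-taut (λ v → ⊨-∧⁻ʳ)

  substPQ : Form n → Form n → Atom → Form n
  substPQ φ ψ 1 = ψ
  substPQ φ ψ _ = φ

  ⊢K : ∀ i φ ψ → ⊢ □ i (φ ⇒ ψ) ⇒ □ i φ ⇒ □ i ψ
  ⊢K i φ ψ = us (substPQ φ ψ) (axK i)

  ⊢T : ∀ i φ → ⊢ □ i φ ⇒ φ
  ⊢T i φ = us (substPQ φ φ) (axT i)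

  ⊢4 : ∀ i φ → ⊢ □ i φ ⇒ □ i (□ i φ)
  ⊢4 i φ = us (substPQ φ φ) (ax4 i)

  ⊢5 : ∀ i φ → ⊢ ◇ i φ ⇒ □ i (◇ i φ)
  ⊢5 i φ = us (substPQ φ φ) (ax5 i)

  ⊢□-mono : ∀ {i φ ψ} → ⊢ φ ⇒ ψ → ⊢ □ i φ ⇒ □ i ψ
  ⊢□-mono {i} {φ} {ψ} ⊢φ⇒ψ = mp (⊢K i φ ψ) (nec i ⊢φ⇒ψ)

  module _ {Γ : MCS} where

    ∋-□-mono : ∀ {i φ ψ} → ⊢ φ ⇒ ψ → Γ ∋ □ i φ → Γ ∋ □ i ψ
    ∋-□-mono = ∋-⊢mp ∘ ⊢□-mono

    ∋-□⋀ₗ : ∀ {i} l → All (λ φ → Γ ∋ □ i φ) l → Γ ∋ □ i (⋀ₗ l)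
    ∋-□⋀ₗ {i} []      []         = ∋-⊢ (nec i (⊢-taut (λ v → ⊨-⊤)))
    ∋-□⋀ₗ {i} (φ ∷ l) (m ∷ ms) =
      ∋-mp (∋-⊢mp (⊢K i _ _) (∋-□-mono (⊢-taut (λ v → ⊨-⇒⁺ (λ s → ⊨-⇒⁺ (⊨-∧⁺ s)))) m))
           (∋-□⋀ₗ l ms)

    ∋-T : ∀ {i φ} → Γ ∋ □ i φ → Γ ∋ φ
    ∋-T = ∋-⊢mp (⊢T _ _)

    ∋-4 : ∀ {i φ} → Γ ∋ □ i φ → Γ ∋ □ i (□ i φ)
    ∋-4 = ∋-⊢mp (⊢4 _ _)

    ∋-◇~ : ∀ {i φ} → ¬ Γ ∋ □ i φ → Γ ∋ ◇ i (~ φ)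
    ∋-◇~ ∌□φ = ∋-~⁺ (∌□φ ∘ ∋-□-mono (⊢-taut (λ v → ⊨-⇒⁺ ⊨-~~⁻)))

    ∋-5 : ∀ {i φ} → ¬ Γ ∋ □ i φ → Γ ∋ □ i (~ □ i φ)
    ∋-5 {i} {φ} ∌□φ =
      ∋-□-mono (⊢-taut⇒ (⊢□-mono {i} {φ} {~ ~ φ} (⊢-taut (λ v → ⊨-⇒⁺ (λ s → ⊨-~⁺ (λ t → ⊨-~⁻ t s)))))
                        (λ v □φ⇒□~~φ → ⊨-⇒⁺ (λ ◇~φ → ⊨-~⁺ (⊨-~⁻ ◇~φ ∘ ⊨-⇒⁻ □φ⇒□~~φ))))
               (∋-⊢mp (⊢5 i (~ φ)) (∋-◇~ ∌□φ))

  -- For S5 this coincides with the usual canonical relation {φ | □ᵢ φ ∈ Γ} ⊆ Δ.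
  infix 4 _~[_]_
  _~[_]_ : MCS → Fin n → MCS → Set
  Γ ~[ i ] Δ = ∀ φ → Γ ∋ □ i φ ⇔ Δ ∋ □ i φ

  ~-refl : ∀ {Γ i} → Γ ~[ i ] Γ
  ~-refl φ = ⇔.refl

  ~-sym : ∀ {Γ Δ i} → Γ ~[ i ] Δ → Δ ~[ i ] Γ
  ~-sym Γ~Δ φ = ⇔.sym (Γ~Δ φ)

  ~-trans : ∀ {Γ Δ Θ i} → Γ ~[ i ] Δ → Δ ~[ i ] Θ → Γ ~[ i ] Θ
  ~-trans Γ~Δ Δ~Θ φ = ⇔.trans (Γ~Δ φ) (Δ~Θ φ)

  ~-□⁻ : ∀ {Γ Δ i φ} → Γ ~[ i ] Δ → Γ ∋ □ i φ → Δ ∋ φ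
  ~-□⁻ Γ~Δ = ∋-T ∘ Equivalence.to (Γ~Δ _)

  ~-◇⁺ : ∀ {Γ Δ i φ} → Γ ~[ i ] Δ → Δ ∋ φ → Γ ∋ ◇ i φ
  ~-◇⁺ Γ~Δ mφ = ∋-~⁺ (λ m□~φ → ∋-~⁻ (~-□⁻ Γ~Δ m□~φ) mφ)

  ⊢-~⋁ : ∀ {k} (f : Fin k → Form n) → (∀ i → ⊢ ~ f i) → ⊢ ~ ⋁ f
  ⊢-~⋁ {zero}        f _ = ⊢-taut (λ v → ⊨-~⁺ (λ s → ⊨-~⁻ (⊨-∧⁻ʳ s) (⊨-∧⁻ˡ s)))
  ⊢-~⋁ {suc zero}    f ⊢~f = ⊢~f zero
  ⊢-~⋁ {suc (suc k)} f ⊢~f =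
    ⊢-taut⇒₂ (⊢~f zero) (⊢-~⋁ (f ∘ suc) (⊢~f ∘ suc)) (λ v s t → ⊨-~⁺ (λ u → ⊨-~⁻ u (⊨-∧⁺ s t)))

  ⊢-~𝕊 : ∀ {φ} → ⊢ ~ φ → ⊢ ~ 𝕊 φ
  ⊢-~𝕊 ⊢~φ = ⊢-~⋁ _ (λ i → ⊢-taut⇒ (nec i ⊢~φ) (λ v s → ⊨-~⁺ (λ t → ⊨-~⁻ t s)))

  module _ {Γ : MCS} where

    ∋-⋀⁺ : ∀ {k} (f : Fin k → Form n) → (∀ i → Γ ∋ f i) → Γ ∋ ⋀ f
    ∋-⋀⁺ {zero}        f _  = ∋-⊢ (⊢-taut (λ v → ⊨-⊤))
    ∋-⋀⁺ {suc zero}    f ms = ms zero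
    ∋-⋀⁺ {suc (suc k)} f ms = ∋-∧⁺ (ms zero) (∋-⋀⁺ (f ∘ suc) (ms ∘ suc))

    ∋-⋁⁺ : ∀ {k} (f : Fin k → Form n) i → Γ ∋ f i → Γ ∋ ⋁ f
    ∋-⋁⁺ f i = ∋-taut (λ v → ⊨-⋁⁺ f i)

  module LocalParts (D : Fin n → MCS) where

    LocalIn : Form n → Set
    LocalIn ψ = ∃ λ i → Local i ψ × D i ∋ ψ

    part : ∀ i l → All LocalIn l → Σ (Form n) (λ ψ → Local i ψ × D i ∋ ψ)
    part i []      []                   = □ i ⊤f , box ⊤f , ∋-⊢ (nec i (⊢-taut (λ v → ⊨-⊤)))
    part i (ψ ∷ l) ((k , loc , m) ∷ xs) with k ≟ i | part i l xs
    ... | yes refl | χ , locχ , mχ = ψ ∧' χ , conj loc locχ , ∋-∧⁺ m mχ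
    ... | no _     | χ             = χ

    part-∷ : ∀ {v} i ψ l (x : LocalIn ψ) xs → v ⊨ proj₁ (part i (ψ ∷ l) (x ∷ xs)) →
             (proj₁ x ≡ i → v ⊨ ψ) × v ⊨ proj₁ (part i l xs)
    part-∷ i ψ l (k , _) xs s with k ≟ i
    ... | yes refl = (λ _ → ⊨-∧⁻ˡ s) , ⊨-∧⁻ʳ s
    ... | no k≢i   = (λ k≡i → ⊥-elim (k≢i k≡i)) , s

    parts-cover : ∀ {v} l xs → (∀ i → v ⊨ proj₁ (part i l xs)) → v ⊨ ⋀ₗ l
    parts-cover []      []       _ = ⊨-⊤
    parts-cover (ψ ∷ l) (x ∷ xs) s =
      ⊨-∧⁺ (proj₁ (part-∷ (proj₁ x) ψ l x xs (s (proj₁ x))) refl)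
           (parts-cover l xs (λ i → proj₂ (part-∷ i ψ l x xs (s i))))

  formulas : ℕ → List (Form n)
  formulas zero    = []
  formulas (suc k) = atom k ∷ fs ++ map ~_ fs ++ cartesianProductWith _∧'_ fs fs
                                     ++ cartesianProductWith □ (allFin n) fs
    where
    fs : List (Form n)
    fs = formulas k

  formulas-mono : ∀ {k k'} → k ≤ k' → formulas k ⊆ formulas k'
  formulas-mono = chain-⊆ formulas (λ k → there ∘ xs⊆xs++ys (formulas k) _)

  formulas-complete : ∀ φ → ∃ λ k → φ ∈ formulas k
  formulas-complete (atom a) = suc a , here refl
  formulas-complete (~ φ) with formulas-complete φ
  ... | k , φ∈ = suc k , there (∈-++⁺ʳ (formulas k) (∈-++⁺ˡ (∈-map⁺ ~_ φ∈)))
  formulas-complete (φ ∧' ψ) with formulas-complete φ | formulas-complete ψ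
  ... | k , φ∈ | k' , ψ∈ = suc (k ⊔ k') , there
    (∈-++⁺ʳ fs (∈-++⁺ʳ (map ~_ fs) (∈-++⁺ˡ (∈-cartesianProductWith⁺ _∧'_
       (formulas-mono (m≤m⊔n k k') φ∈) (formulas-mono (m≤n⊔m k k') ψ∈)))))
    where
    fs : List (Form n)
    fs = formulas (k ⊔ k')
  formulas-complete (□ i φ) with formulas-complete φ
  ... | k , φ∈ = suc k , there
    (∈-++⁺ʳ fs (∈-++⁺ʳ (map ~_ fs) (∈-++⁺ʳ (cartesianProductWith _∧'_ fs fs)
       (∈-cartesianProductWith⁺ □ (∈-allFin i) φ∈))))
    where
    fs : List (Form n)
    fs = formulas k

-- F is the full product Aⁿ, with R i the agreement of i-th coordinates; realize is a section
-- of coord only pointwise, as there is no function extensionality.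
record ProductPresentation {n : ℕ} (A : Set) (F : Frame n) : Set where
  field
    coord         : Frame.W F → Fin n → A
    R⇔agree       : ∀ i {w w'} → Frame.R F i w w' ⇔ (coord w i ≡ coord w' i)
    realize       : (Fin n → A) → Frame.W F
    coord-realize : ∀ g i → coord (realize g) i ≡ g i

lookup-ext : ∀ {A : Set} {n} (xs ys : Vec A n) → (∀ i → lookup xs i ≡ lookup ys i) → xs ≡ ys
lookup-ext xs ys agree = begin
  xs                   ≡⟨ tabulate∘lookup xs ⟨
  tabulate (lookup xs) ≡⟨ tabulate-cong agree ⟩
  tabulate (lookup ys) ≡⟨ tabulate∘lookup ys ⟩
  ys                   ∎
  where open ≡.≡-Reasoning

module _ {n : ℕ} (A : Set) (a : A) where

  hypercubeSystem : System n
  hypercubeSystem = record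
    { Le = ⊤ ; L = λ _ → A ; S = λ _ → true ; nonempty = (tt , λ _ → a) , refl }

  hypercubeSystem-isHypercube : IsHypercube hypercubeSystem
  hypercubeSystem-isHypercube = (tt , λ _ → refl) , (λ _ → a) , (λ _ → refl)

  hypercubeSystem-presentation : ProductPresentation A (frameOf hypercubeSystem)
  hypercubeSystem-presentation = record
    { coord = λ g → proj₂ (proj₁ g) ; R⇔agree = λ i → ⇔.refl
    ; realize = λ g → (tt , g) , refl ; coord-realize = λ g i → refl }

  productFrame : Frame n
  productFrame = record
    { W = Vec A n ; w₀ = replicate n a ; R = λ i v v' → lookup v i ≡ lookup v' i }

  productFrame-isEDI : IsEDI productFrame
  productFrame-isEDI =
      (λ i → record { refl = refl ; sym = sym ; trans = ≡.trans })
    , (λ vs → tabulate (λ i → lookup (vs i) i) , λ i → sym (lookup∘tabulate _ i))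
    , (λ v v' → mk⇔ (lookup-ext v v') (λ { refl i → refl }))

  productFrame-presentation : ProductPresentation A productFrame
  productFrame-presentation = record
    { coord = lookup ; R⇔agree = λ i → ⇔.refl ; realize = tabulate ; coord-realize = lookup∘tabulate }

module _ {n : ℕ} where

  EDI⇒ED : (F : Frame n) → IsEDI F → IsED F
  EDI⇒ED F (equiv , directed , _) = equiv , directed

  hypercube⇒full : (Sys : System n) → IsHypercube Sys → IsFull Sys
  hypercube⇒full Sys ((e , _) , _ , all-in) ls = e , all-in (e , ls)

  full⇒ED : (Sys : System n) → IsFull Sys → IsED (frameOf Sys)
  full⇒ED Sys full = (λ i → record { refl = refl ; sym = sym ; trans = ≡.trans }) , directed
    where
    open System Sys
    directed : Directed (frameOf Sys)
    directed gs = ((proj₁ (full ls) , ls) , proj₂ (full ls)) , λ i → refl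
      where
      ls : (i : Fin n) → L i
      ls i = proj₂ (proj₁ (gs i)) i

module Classical (lem : ExcludedMiddle 0ℓ) where

  classical : ∀ {P : Set} → ¬ ¬ P → P
  classical = decidable-stable lem

  module _ {n : ℕ} (F : Frame n) where
    open Frame F

    sat-⋁⁻ : ∀ {π w k} (f : Fin k → Form n) → sat F π w (⋁ f) → ∃ λ i → sat F π w (f i)
    sat-⋁⁻ {k = zero}        f (s , ¬s) = ⊥-elim (¬s s)
    sat-⋁⁻ {k = suc zero}    f s = zero , s
    sat-⋁⁻ {k = suc (suc k)} f s = classical λ ∄i →
      s ((λ s₀ → ∄i (zero , s₀)) , (λ s' → ∄i (Product.map suc id (sat-⋁⁻ (f ∘ suc) s'))))

    sat-⋁⁺ : ∀ {π w k} (f : Fin k → Form n) i → sat F π w (f i) → sat F π w (⋁ f)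
    sat-⋁⁺ {k = suc zero}    f zero    s = s
    sat-⋁⁺ {k = suc (suc k)} f zero    s = λ (¬s , _) → ¬s s
    sat-⋁⁺ {k = suc (suc k)} f (suc i) s = λ (_ , ¬s) → ¬s (sat-⋁⁺ (f ∘ suc) i s)

    sat-⋀⁻ : ∀ {π w k} (f : Fin k → Form n) → sat F π w (⋀ f) → ∀ i → sat F π w (f i)
    sat-⋀⁻ {k = suc zero}    f s zero    = s
    sat-⋀⁻ {k = suc (suc k)} f s zero    = proj₁ s
    sat-⋀⁻ {k = suc (suc k)} f s (suc i) = sat-⋀⁻ (f ∘ suc) (proj₂ s) i

    sat-⋀⁺ : ∀ {π w k} (f : Fin k → Form n) → (∀ i → sat F π w (f i)) → sat F π w (⋀ f)
    sat-⋀⁺ {k = zero}        f _ = λ (s , ¬s) → ¬s s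
    sat-⋀⁺ {k = suc zero}    f s = s zero
    sat-⋀⁺ {k = suc (suc k)} f s = s zero , sat-⋀⁺ (f ∘ suc) (s ∘ suc)

    sat-◇⁻ : ∀ {π w i φ} → sat F π w (◇ i φ) → ∃ λ u → R i w u × sat F π u φ
    sat-◇⁻ s = classical (λ ∄u → s (λ u r sφ → ∄u (u , r , sφ)))

    sat-◇⁺ : ∀ {π w u i φ} → R i w u → sat F π u φ → sat F π w (◇ i φ)
    sat-◇⁺ {u = u} r sφ □¬φ = □¬φ u r sφ

    sat-taut : ∀ {π w φ} → Tautology φ → sat F π w φ
    sat-taut {π} {w} {φ} t = Equivalence.to (T-tv φ) (Equivalence.from T-≡ (t v))
      where
      v : Form n → Bool
      v ψ = isYes (lem {sat F π w ψ})

      T-tv : ∀ ψ → T (tv v ψ) ⇔ sat F π w ψ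
      T-tv (atom a) = mk⇔ toWitness fromWitness
      T-tv (~ ψ)    = ⇔.trans T-not (¬-cong-⇔ (T-tv ψ))
      T-tv (ψ ∧' χ) = ⇔.trans T-∧ (T-tv ψ ×-⇔ T-tv χ)
      T-tv (□ i ψ)  = mk⇔ toWitness fromWitness

    sat-subst : ∀ {π} σ φ {w} → sat F π w (subst σ φ) ⇔
                sat F (λ u a → isYes (lem {sat F π u (σ a)})) w φ
    sat-subst σ (atom a) = mk⇔ (Equivalence.to T-≡ ∘ fromWitness) (toWitness ∘ Equivalence.from T-≡)
    sat-subst σ (~ φ)    = ¬-cong-⇔ (sat-subst σ φ)
    sat-subst σ (φ ∧' ψ) = sat-subst σ φ ×-⇔ sat-subst σ ψ
    sat-subst σ (□ i φ)  = mk⇔ (λ s u r → Equivalence.to (sat-subst σ φ) (s u r))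
                               (λ s u r → Equivalence.from (sat-subst σ φ) (s u r))

    sat-local : IsEquivFrame F → ∀ {π u u' i φ} → Local i φ → R i u u' → sat F π u φ → sat F π u' φ
    sat-local equiv {i = i} (box φ)     r s  u r' = s u (IsEquivalence.trans (equiv i) r r')
    sat-local equiv {i = i} (neg loc)   r ¬s s    = ¬s (sat-local equiv loc (IsEquivalence.sym (equiv i) r) s)
    sat-local equiv (conj loc loc')     r (s , s') = sat-local equiv loc r s , sat-local equiv loc' r s'

  module _ {m : ℕ} {F : Frame (suc m)} (equiv : IsEquivFrame F) (directed : Directed F) where
    open Frame F
    module R≈ i = IsEquivalence (equiv i)

    sat-WD : ∀ {π w} (φs : Fin (suc m) → Form (suc m)) → (∀ i → Local i (φs i)) →
             sat F π w (⋀ (λ i → 𝕊 (φs i))) → sat F π w (𝕊 (𝕊 (⋀ φs)))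
    sat-WD {π} {w} φs loc s =
      sat-⋁⁺ F (λ j → ◇ j (𝕊 (⋀ φs))) (agent zero)
        (sat-◇⁺ F (w~u zero) (sat-⋁⁺ F (λ j → ◇ j (⋀ φs)) zero (sat-◇⁺ F (u~x̄ zero) φs-at-x̄)))
      where
      witness : ∀ i → ∃₂ λ k u → R k w u × sat F π u (φs i)
      witness i with sat-⋁⁻ F _ (sat-⋀⁻ F _ s i)
      ... | k , s◇ = k , sat-◇⁻ F s◇

      agent : Fin (suc m) → Fin (suc m)
      agent i = proj₁ (witness i)

      u : Fin (suc m) → W
      u i = proj₁ (proj₂ (witness i))

      w~u : ∀ i → R (agent i) w (u i)
      w~u i = proj₁ (proj₂ (proj₂ (witness i)))

      x̄ : W
      x̄ = proj₁ (directed u)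

      u~x̄ : ∀ i → R i (u i) x̄
      u~x̄ = proj₂ (directed u)

      φs-at-x̄ : sat F π x̄ (⋀ φs)
      φs-at-x̄ = sat-⋀⁺ F φs λ i → sat-local F equiv (loc i) (u~x̄ i) (proj₂ (proj₂ (proj₂ (witness i))))

    -- sat π w (φ ⇒ ψ) unfolds to ¬ (sat π w φ × ¬ sat π w ψ).
    sound : ∀ {φ} → ⊢ φ → ValidOn F φ
    sound (taut t)      π w = sat-taut F t
    sound (axK i)       π w (□[p⇒q] , ¬[□p⇒□q]) =
      ¬[□p⇒□q] λ (□p , ¬□q) → ¬□q λ u r → classical λ ¬q → □[p⇒q] u r (□p u r , ¬q)
    sound (axT i)       π w (□p , ¬p)    = ¬p (□p w (R≈.refl i))
    sound (ax4 i)       π w (□p , ¬□□p)  = ¬□□p λ u r u' r' → □p u' (R≈.trans i r r')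
    sound (ax5 i)       π w (◇p , ¬□◇p)  =
      ¬□◇p λ u r □¬p → ◇p λ u' r' → □¬p u' (R≈.trans i (R≈.sym i r) r')
    sound (axWD φs loc) π w (s , ¬SS)    = ¬SS (sat-WD φs loc s)
    sound (mp ⊢φ⇒ψ ⊢φ)  π w = classical λ ¬ψ → sound ⊢φ⇒ψ π w (sound ⊢φ π w , ¬ψ)
    sound (nec i ⊢φ)    π w u _ = sound ⊢φ π u
    sound (us σ ⊢φ)     π w = Equivalence.from (sat-subst F σ _) (sound ⊢φ _ w)

  ED-sound : ∀ {m φ} {F : Frame (suc m)} → ⊢ φ → IsED F → ValidOn F φ
  ED-sound ⊢φ (equiv , directed) = sound equiv directed ⊢φ

  module _ {n : ℕ} where

    module Lindenbaum (X : Form n → Set) (X-consistent : Consistent X) where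

      Inconsistent : List (Form n) → Set
      Inconsistent A = ∃ λ l → All X l × ⊢ ~ (⋀ₗ A ∧' ⋀ₗ l)

      choose : ∀ A φ → Dec (Inconsistent (φ ∷ A)) → List (Form n)
      choose A φ (yes _) = ~ φ ∷ A
      choose A φ (no _)  = φ ∷ A

      choose-consistent : ∀ {A φ} (d : Dec (Inconsistent (φ ∷ A))) →
                          ¬ Inconsistent A → ¬ Inconsistent (choose A φ d)
      choose-consistent (no ¬inc) _ = ¬inc
      choose-consistent {A} {φ} (yes (l , xs , ⊢¬φA)) consA (l' , xs' , ⊢¬~φA) =
        consA (l ++ l' , All.++⁺ xs xs' , ⊢-taut⇒₂ ⊢¬φA ⊢¬~φA refute)
        where
        refute : ∀ v → v ⊨ ~ ((φ ∧' ⋀ₗ A) ∧' ⋀ₗ l) → v ⊨ ~ ((~ φ ∧' ⋀ₗ A) ∧' ⋀ₗ l') →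
                 v ⊨ ~ (⋀ₗ A ∧' ⋀ₗ (l ++ l'))
        refute v s t = ⊨-~⁺ λ u → case-φ (⊨-∧⁻ˡ u) (⊨-∧⁻ʳ u)
          where
          case-φ : v ⊨ ⋀ₗ A → v ⊨ ⋀ₗ (l ++ l') → ⊥
          case-φ sA sl with ⊨-dec φ
          ... | yes sφ = ⊨-~⁻ s (⊨-∧⁺ (⊨-∧⁺ sφ sA) (⊨-⋀ₗ-mono (xs⊆xs++ys l l') sl))
          ... | no ¬sφ = ⊨-~⁻ t (⊨-∧⁺ (⊨-∧⁺ (⊨-~⁺ ¬sφ) sA) (⊨-⋀ₗ-mono (xs⊆ys++xs l' l) sl))

      choose-⊇ : ∀ {A φ} (d : Dec (Inconsistent (φ ∷ A))) → A ⊆ choose A φ d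
      choose-⊇ (yes _) = there
      choose-⊇ (no _)  = there

      choose-decides : ∀ {A φ} (d : Dec (Inconsistent (φ ∷ A))) →
                       φ ∈ choose A φ d ⊎ ~ φ ∈ choose A φ d
      choose-decides (yes _) = inj₂ (here refl)
      choose-decides (no _)  = inj₁ (here refl)

      step : List (Form n) → Form n → List (Form n)
      step A φ = choose A φ lem

      foldl-consistent : ∀ {A} φs → ¬ Inconsistent A → ¬ Inconsistent (foldl step A φs)
      foldl-consistent []       = id
      foldl-consistent (φ ∷ φs) = foldl-consistent φs ∘ choose-consistent lem

      foldl-⊇ : ∀ {A} φs → A ⊆ foldl step A φs
      foldl-⊇ []       = id
      foldl-⊇ (φ ∷ φs) = foldl-⊇ φs ∘ choose-⊇ lem

      foldl-decides : ∀ {A φ} φs → φ ∈ φs → φ ∈ foldl step A φs ⊎ ~ φ ∈ foldl step A φs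
      foldl-decides (φ ∷ φs) (here refl) = Sum.map (foldl-⊇ φs) (foldl-⊇ φs) (choose-decides lem)
      foldl-decides (ψ ∷ φs) (there φ∈)  = foldl-decides φs φ∈

      stage : ℕ → List (Form n)
      stage zero    = []
      stage (suc k) = foldl step (stage k) (formulas k)

      stage-consistent : ∀ k → ¬ Inconsistent (stage k)
      stage-consistent zero (l , xs , ⊢¬l) =
        X-consistent l xs (⊢-taut⇒ ⊢¬l (λ v s → ⊨-~⁺ (λ t → ⊨-~⁻ s (⊨-∧⁺ ⊨-⊤ t))))
      stage-consistent (suc k) = foldl-consistent (formulas k) (stage-consistent k)

      stage-mono : ∀ {k k'} → k ≤ k' → stage k ⊆ stage k'
      stage-mono = chain-⊆ stage (λ k → foldl-⊇ (formulas k))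

      Chosen : Form n → Set
      Chosen φ = X φ ⊎ ∃ λ k → φ ∈ stage k

      collect : ∀ l → All Chosen l → ∃₂ λ lx K → All X lx × l ⊆ lx ++ stage K
      collect []      []                       = [] , 0 , [] , λ ()
      collect (φ ∷ l) (inj₁ xφ ∷ ins)          with collect l ins
      ... | lx , K , xs , l⊆ = φ ∷ lx , K , xφ ∷ xs ,
        λ { (here refl) → here refl ; (there p) → there (l⊆ p) }
      collect (φ ∷ l) (inj₂ (k , φ∈) ∷ ins) with collect l ins
      ... | lx , K , xs , l⊆ = lx , k ⊔ K , xs ,
        λ { (here refl) → ∈-++⁺ʳ lx (stage-mono (m≤m⊔n k K) φ∈)
          ; (there p)   → ⊆.++⁺ʳ lx (stage-mono (m≤n⊔m k K)) (l⊆ p) }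

      Chosen-consistent : Consistent Chosen
      Chosen-consistent l ins ⊢¬l with collect l ins
      ... | lx , K , xs , l⊆ = stage-consistent K (lx , xs , ⊢-taut⇒ ⊢¬l (λ v s → ⊨-~⁺ λ t →
              ⊨-~⁻ s (⊨-⋀ₗ-mono l⊆ (⊨-⋀ₗ⁺ (All.++⁺ (⊨-⋀ₗ⁻ lx (⊨-∧⁻ʳ t)) (⊨-⋀ₗ⁻ (stage K) (⊨-∧⁻ˡ t)))))))

      Chosen-complete : ∀ φ → Chosen φ ⊎ Chosen (~ φ)
      Chosen-complete φ with formulas-complete φ
      ... | k , φ∈ =
        Sum.map (λ p → inj₂ (suc k , p)) (λ p → inj₂ (suc k , p)) (foldl-decides (formulas k) φ∈)

      Γ : MCS
      Γ = record
        { mem        = λ φ → isYes (lem {Chosen φ})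
        ; complete   = λ φ → Sum.map fromWitness fromWitness (Chosen-complete φ)
        ; consistent = λ l ms → Chosen-consistent l (All.map toWitness ms)
        }

    lindenbaum : ∀ {X} → Consistent X → Σ MCS (λ Γ → ∀ {φ} → X φ → Γ ∋ φ)
    lindenbaum {X} X-consistent = Γ , λ xφ → ⟪ fromWitness (inj₁ xφ) ⟫
      where open Lindenbaum X X-consistent

    ◇-witness : ∀ {Γ i φ} → Γ ∋ ◇ i φ → ∃ λ Δ → Γ ~[ i ] Δ × Δ ∋ φ
    ◇-witness {Γ} {i} {φ} m◇φ = Δ , Γ~Δ , ⊇X (inj₂ refl)
      where
      X : Form n → Set
      X ψ = Γ ∋ □ i ψ ⊎ ψ ≡ φ

      □[φ⇒_] : ∀ {ψ} → X ψ → Γ ∋ □ i (φ ⇒ ψ)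
      □[φ⇒_] (inj₁ m□ψ) = ∋-□-mono (⊢-taut (λ v → ⊨-⇒⁺ (λ s → ⊨-⇒⁺ (λ _ → s)))) m□ψ
      □[φ⇒_] (inj₂ refl) = ∋-⊢ (nec i (⊢-taut (λ v → ⊨-⇒⁺ id)))

      X-consistent : Consistent X
      X-consistent l xs ⊢¬l =
        ∋-~⁻ m◇φ (∋-□-mono ⊢⋀[φ⇒l]⇒~φ (∋-□⋀ₗ (map (φ ⇒_) l) (All.map⁺ (All.map □[φ⇒_] xs))))
        where
        ⊢⋀[φ⇒l]⇒~φ : ⊢ ⋀ₗ (map (φ ⇒_) l) ⇒ ~ φ
        ⊢⋀[φ⇒l]⇒~φ = ⊢-taut⇒ ⊢¬l (λ v s → ⊨-⇒⁺ λ t → ⊨-~⁺ λ sφ →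
          ⊨-~⁻ s (⊨-⋀ₗ⁺ (All.map (λ u → ⊨-⇒⁻ u sφ) (All.map⁻ (⊨-⋀ₗ⁻ (map (φ ⇒_) l) t)))))

      Δ : MCS
      Δ = proj₁ (lindenbaum X-consistent)

      ⊇X : ∀ {ψ} → X ψ → Δ ∋ ψ
      ⊇X = proj₂ (lindenbaum X-consistent)

      Γ~Δ : Γ ~[ i ] Δ
      Γ~Δ ψ = mk⇔ (⊇X ∘ inj₁ ∘ ∋-4) (λ m → classical (λ ∌ → ∋-~⁻ (⊇X (inj₁ (∋-5 ∌))) m))

    canonical-wd : ∀ {Γ} (D : Fin n → MCS) → (∀ i → ∃ λ j → Γ ~[ j ] D i) →
                   ∃ λ Θ → ∀ i → D i ~[ i ] Θ
    canonical-wd {Γ} D near = Θ , D~Θ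
      where
      open LocalParts D

      LocalIn-consistent : Consistent LocalIn
      LocalIn-consistent l xs ⊢¬l = ∋-~⁻ (∋-⊢ (⊢-~𝕊 (⊢-~𝕊 ⊢¬⋀φs))) (∋-⊢mp (axWD φs locφs) 𝕊φs)
        where
        φs : Fin n → Form n
        φs i = proj₁ (part i l xs)

        locφs : ∀ i → Local i (φs i)
        locφs i = proj₁ (proj₂ (part i l xs))

        𝕊φs : Γ ∋ ⋀ (λ i → 𝕊 (φs i))
        𝕊φs = ∋-⋀⁺ _ λ i → ∋-⋁⁺ _ (proj₁ (near i)) (~-◇⁺ (proj₂ (near i)) (proj₂ (proj₂ (part i l xs))))

        ⊢¬⋀φs : ⊢ ~ ⋀ φs
        ⊢¬⋀φs = ⊢-taut⇒ ⊢¬l (λ v s → ⊨-~⁺ (⊨-~⁻ s ∘ parts-cover l xs ∘ ⊨-⋀⁻ φs))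

      Θ : MCS
      Θ = proj₁ (lindenbaum LocalIn-consistent)

      ⊇LocalIn : ∀ {ψ} → LocalIn ψ → Θ ∋ ψ
      ⊇LocalIn = proj₂ (lindenbaum LocalIn-consistent)

      D~Θ : ∀ i → D i ~[ i ] Θ
      D~Θ i ψ = mk⇔ (λ m → ⊇LocalIn (i , box ψ , m))
                    (λ m → classical λ ∌ → ∋-~⁻ (⊇LocalIn (i , neg (box ψ) , ∋-~⁺ ∌)) m)

    canonical-wd₂ : ∀ {Γ Δ Δ' a a'} → Γ ~[ a ] Δ → Γ ~[ a' ] Δ' → ∀ k →
                    ∃ λ Θ → Δ ~[ k ] Θ × (∀ j → j ≢ k → Δ' ~[ j ] Θ)
    canonical-wd₂ {Γ} {Δ} {Δ'} {a} {a'} Γ~Δ Γ~Δ' k =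
      Θ , ≡.subst (_~[ k ] Θ) (updateAt-updates k _) (D~Θ k)
        , λ j j≢k → ≡.subst (_~[ j ] Θ) (updateAt-minimal j k _ j≢k) (D~Θ j)
      where
      D : Fin n → MCS
      D = updateAt (const Δ') k (const Δ)

      near : ∀ j → ∃ λ c → Γ ~[ c ] D j
      near j with j ≟ k
      ... | yes refl = a  , ≡.subst (Γ ~[ a ]_) (sym (updateAt-updates j _)) Γ~Δ
      ... | no j≢k   = a' , ≡.subst (Γ ~[ a' ]_) (sym (updateAt-minimal j k _ j≢k)) Γ~Δ'

      Θ : MCS
      Θ = proj₁ (canonical-wd D near)

      D~Θ : ∀ j → D j ~[ j ] Θ
      D~Θ = proj₂ (canonical-wd D near)

  module _ {m : ℕ} where

    infix 4 _⇝_
    _⇝_ : MCS {suc m} → MCS → Set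
    Γ ⇝ Δ = ∃ λ Θ → ∃₂ λ a b → Γ ~[ a ] Θ × Θ ~[ b ] Δ

    ⇝-refl : ∀ {Γ} → Γ ⇝ Γ
    ⇝-refl {Γ} = Γ , zero , zero , ~-refl , ~-refl

    ⇝-sym : ∀ {Γ Δ} → Γ ⇝ Δ → Δ ⇝ Γ
    ⇝-sym (Θ , a , b , Γ~Θ , Θ~Δ) = Θ , b , a , ~-sym Θ~Δ , ~-sym Γ~Θ

    ~⇒⇝ : ∀ {Γ Δ i} → Γ ~[ i ] Δ → Γ ⇝ Δ
    ~⇒⇝ {Δ = Δ} Γ~Δ = Δ , _ , zero , Γ~Δ , ~-refl

    -- Weak directedness at Δ₁ joins the b-class of Γ with the c-class of Δ₂.
    shortcut : ∀ {Γ Δ₁ Δ₂ Δ₃ a b c} → Γ ~[ a ] Δ₁ → Δ₁ ~[ b ] Δ₂ → Δ₂ ~[ c ] Δ₃ → Γ ⇝ Δ₃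
    shortcut {b = b} {c} Γ~Δ₁ Δ₁~Δ₂ Δ₂~Δ₃ with b ≟ c
    ... | yes refl = _ , _ , b , Γ~Δ₁ , ~-trans Δ₁~Δ₂ Δ₂~Δ₃
    ... | no b≢c   =
      let Θ , Γ~Θ , Δ₂~Θ = canonical-wd₂ (~-sym Γ~Δ₁) Δ₁~Δ₂ b
      in Θ , b , c , Γ~Θ , ~-trans (~-sym (Δ₂~Θ c (b≢c ∘ sym))) Δ₂~Δ₃

    ⇝-trans : ∀ {Γ Δ Ξ} → Γ ⇝ Δ → Δ ⇝ Ξ → Γ ⇝ Ξ
    ⇝-trans (_ , _ , _ , Γ~Θ , Θ~Δ) (_ , _ , _ , Δ~Θ' , Θ'~Ξ) =
      let _ , _ , _ , Γ~Θ'' , Θ''~Θ' = shortcut Γ~Θ Θ~Δ Δ~Θ'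
      in shortcut Γ~Θ'' Θ''~Θ' Θ'~Ξ

    component-directed : ∀ {Γ₀} (D : Fin (suc m) → MCS) → (∀ i → Γ₀ ⇝ D i) →
                         ∃ λ Θ → Γ₀ ⇝ Θ × (∀ i → D i ~[ i ] Θ)
    component-directed {Γ₀} D reach =
      let Θ , Γ₀⇝Θ , D~Θ = join (allFin _)
      in Θ , Γ₀⇝Θ , λ i → All.lookup D~Θ (∈-allFin i)
      where
      Joined : List (Fin (suc m)) → Set
      Joined is = ∃ λ Θ → Γ₀ ⇝ Θ × All (λ i → D i ~[ i ] Θ) is

      moved : ∀ k {Θ Θ' is} → D k ~[ k ] Θ' → (∀ j → j ≢ k → Θ ~[ j ] Θ') →
              All (λ i → D i ~[ i ] Θ) is → All (λ i → D i ~[ i ] Θ') is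
      moved k Dk~Θ' Θ~Θ' = All.map λ {i} Di~Θ → case-agent i Di~Θ
        where
        case-agent : ∀ i → D i ~[ i ] _ → D i ~[ i ] _
        case-agent i Di~Θ with i ≟ k
        ... | yes refl = Dk~Θ'
        ... | no i≢k   = ~-trans Di~Θ (Θ~Θ' i i≢k)

      extend : ∀ k {is} → Joined is → Joined (k ∷ is)
      extend k (Θ , Γ₀⇝Θ , D~Θ) =
        let _ , _ , _ , Θ~Ξ , Ξ~Dk = ⇝-trans (⇝-sym Γ₀⇝Θ) (reach k)
            Θ' , Dk~Θ' , Θ~Θ'      = canonical-wd₂ Ξ~Dk (~-sym Θ~Ξ) k
        in Θ' , ⇝-trans (reach k) (~⇒⇝ Dk~Θ') , Dk~Θ' ∷ moved k Dk~Θ' Θ~Θ' D~Θ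

      join : ∀ is → Joined is
      join []       = Γ₀ , ⇝-refl , []
      join (k ∷ is) = extend k (join is)

  module CanonicalModel {m : ℕ} (Γ₀ : MCS {suc (suc m)}) where

    LocalState : Set
    LocalState = Σ MCS (Γ₀ ⇝_) × Bool

    theory : LocalState → MCS
    theory = proj₁ ∘ proj₁

    tag : LocalState → Bool
    tag = proj₂

    GlobalState : Set
    GlobalState = Fin (suc (suc m)) → LocalState

    designatedBy : LocalState → LocalState → Fin (suc (suc m))
    designatedBy l₀ l₁ = if tag l₀ xor tag l₁ then suc zero else zero

    designated : GlobalState → Fin (suc (suc m))
    designated g = designatedBy (g zero) (g (suc zero))

    Coherent : GlobalState → Set
    Coherent g = ∀ j → theory (g j) ~[ j ] theory (g (designated g))

    join : (g : GlobalState) → ∃ λ Θ → Γ₀ ⇝ Θ × (∀ j → theory (g j) ~[ j ] Θ)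
    join g = component-directed (theory ∘ g) (proj₂ ∘ proj₁ ∘ g)

    state : GlobalState → MCS
    state g with lem {Coherent g}
    ... | yes _ = theory (g (designated g))
    ... | no _  = proj₁ (join g)

    state-~ : ∀ g j → theory (g j) ~[ j ] state g
    state-~ g j with lem {Coherent g}
    ... | yes coherent = coherent j
    ... | no _         = proj₂ (proj₂ (join g)) j

    state-⇝ : ∀ g → Γ₀ ⇝ state g
    state-⇝ g = ⇝-trans (proj₂ (proj₁ (g zero))) (~⇒⇝ (state-~ g zero))

    state-≡ : ∀ g {Θ} → (∀ j → theory (g j) ~[ j ] Θ) → theory (g (designated g)) ≡ Θ → state g ≡ Θ
    state-≡ g g~Θ refl with lem {Coherent g}
    ... | yes _          = refl
    ... | no incoherent = ⊥-elim (incoherent g~Θ)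

    -- Makes the designated coordinate of around i l θ differ from i; this needs n ≥ 2.
    tagAway : Fin (suc (suc m)) → LocalState → Bool
    tagAway zero          l = not (tag l)
    tagAway (suc zero)    l = tag l
    tagAway (suc (suc _)) _ = true

    around : Fin (suc (suc m)) → LocalState → Σ MCS (Γ₀ ⇝_) → GlobalState
    around i l θ = updateAt (const (θ , tagAway i l)) i (const l)

    around-designated : ∀ i l θ → theory (around i l θ (designated (around i l θ))) ≡ proj₁ θ
    around-designated zero          (_ , false) θ = refl
    around-designated zero          (_ , true)  θ = refl
    around-designated (suc zero)    (_ , false) θ = refl
    around-designated (suc zero)    (_ , true)  θ = refl
    around-designated (suc (suc _)) l           θ = refl

    around-~ : ∀ i l θ → theory l ~[ i ] proj₁ θ → ∀ j → theory (around i l θ j) ~[ j ] proj₁ θ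
    around-~ i l θ l~θ j with j ≟ i
    ... | yes refl = ≡.subst (λ l' → theory l' ~[ j ] _) (sym (updateAt-updates j _)) l~θ
    ... | no j≢i   = ≡.subst (λ l' → theory l' ~[ j ] _) (sym (updateAt-minimal j i _ j≢i)) ~-refl

    base : LocalState
    base = (Γ₀ , ⇝-refl) , true

    module Truth {F : Frame (suc (suc m))} (P : ProductPresentation LocalState F) where
      open Frame F
      open ProductPresentation P

      worldTheory : W → MCS
      worldTheory w = state (coord w)

      π : Valuation F
      π w a = MCS.mem (worldTheory w) (atom a)

      realize-theory : ∀ g {Θ} → (∀ j → theory (g j) ~[ j ] Θ) → theory (g (designated g)) ≡ Θ →
                       worldTheory (realize g) ≡ Θ
      realize-theory g {Θ} g~Θ designated≡Θ = state-≡ (coord (realize g))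
        (λ j → ≡.subst (λ l → theory l ~[ j ] Θ) (sym (coord-realize g j)) (g~Θ j))
        (begin
          theory (coord (realize g) (designated (coord (realize g))))
            ≡⟨ ≡.cong (λ k → theory (coord (realize g) k))
                      (≡.cong₂ designatedBy (coord-realize g zero) (coord-realize g (suc zero))) ⟩
          theory (coord (realize g) (designated g))
            ≡⟨ ≡.cong theory (coord-realize g (designated g)) ⟩
          theory (g (designated g))
            ≡⟨ designated≡Θ ⟩
          Θ ∎)
        where open ≡.≡-Reasoning

      ∋□⇒sat : ∀ {i φ} → (∀ w → sat F π w φ ⇔ worldTheory w ∋ φ) →
               ∀ w → worldTheory w ∋ □ i φ → sat F π w (□ i φ)
      ∋□⇒sat {i} IH w m□φ u r = Equivalence.from (IH u) (~-□⁻ (state-~ (coord u) i)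
        (≡.subst (λ l → theory l ∋ □ i _) (Equivalence.to (R⇔agree i) r)
                 (Equivalence.from (state-~ (coord w) i _) m□φ)))

      ~-realized : ∀ {i Δ} w → worldTheory w ~[ i ] Δ → ∃ λ w' → R i w w' × worldTheory w' ≡ Δ
      ~-realized {i} {Δ} w w~Δ = realize g , w~w' , realize-theory g (around-~ i (coord w i) θ coord~Δ)
                                                                    (around-designated i (coord w i) θ)
        where
        θ : Σ MCS (Γ₀ ⇝_)
        θ = Δ , ⇝-trans (state-⇝ (coord w)) (~⇒⇝ w~Δ)

        coord~Δ : theory (coord w i) ~[ i ] Δ
        coord~Δ = ~-trans (state-~ (coord w) i) w~Δ

        g : GlobalState
        g = around i (coord w i) θ

        w~w' : R i w (realize g)
        w~w' = Equivalence.from (R⇔agree i) (sym (≡.trans (coord-realize g i) (updateAt-updates i _)))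

      sat□⇒∋ : ∀ {i φ} → (∀ w → sat F π w φ ⇔ worldTheory w ∋ φ) →
               ∀ w → sat F π w (□ i φ) → worldTheory w ∋ □ i φ
      sat□⇒∋ {i} {φ} IH w s□φ = classical λ ∌□φ →
        let Δ , w~Δ , Δ∋~φ   = ◇-witness (∋-◇~ ∌□φ)
            w' , w~w' , w'≡Δ = ~-realized w w~Δ
        in ∋-~⁻ Δ∋~φ (≡.subst (_∋ φ) w'≡Δ (Equivalence.to (IH w') (s□φ w' w~w')))

      truth : ∀ φ w → sat F π w φ ⇔ worldTheory w ∋ φ
      truth (atom a) w = mk⇔ (λ e → ⟪ Equivalence.from T-≡ e ⟫) (Equivalence.to T-≡ ∘ member)
      truth (~ φ)    w = ⇔.trans (¬-cong-⇔ (truth φ w)) (mk⇔ ∋-~⁺ ∋-~⁻)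
      truth (φ ∧' ψ) w = ⇔.trans (truth φ w ×-⇔ truth ψ w)
                                 (mk⇔ (λ (mφ , mψ) → ∋-∧⁺ mφ mψ) (λ m → ∋-∧⁻ˡ m , ∋-∧⁻ʳ m))
      truth (□ i φ)  w = mk⇔ (sat□⇒∋ (truth φ) w) (∋□⇒sat (truth φ) w)

      refutes : ∀ {φ} → Γ₀ ∋ ~ φ → ¬ ValidOn F φ
      refutes {φ} m~φ valid =
        ∋-~⁻ m~φ (≡.subst (_∋ φ) base-theory (Equivalence.to (truth φ _) (valid π _)))
        where
        base-theory : worldTheory (realize (const base)) ≡ Γ₀
        base-theory = realize-theory (const base) (λ _ → ~-refl) refl

  refutable : ∀ {n φ} → ¬ ⊢ φ → ∃ λ (Γ : MCS {n}) → Γ ∋ ~ φ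
  refutable {φ = φ} ⊬φ = Product.map id (λ ⊇ → ⊇ refl) (lindenbaum {X = _≡ ~ φ} ~φ-consistent)
    where
    ~φ-consistent : Consistent (_≡ ~ φ)
    ~φ-consistent l ≡~φ ⊢¬l = ⊬φ (⊢-taut⇒ ⊢¬l (λ v s → classical λ ¬sφ →
      ⊨-~⁻ s (⊨-⋀ₗ⁺ (All.map (λ { refl → ⊨-~⁺ ¬sφ }) ≡~φ))))

  hypercube-complete : ∀ {m φ} → (∀ Sys → IsHypercube Sys → ValidOn (frameOf Sys) φ) →
                       ⊢_ {suc (suc m)} φ
  hypercube-complete valid = classical λ ⊬φ →
    let Γ₀ , m~φ = refutable ⊬φ
        open CanonicalModel Γ₀
    in Truth.refutes (hypercubeSystem-presentation LocalState base) m~φ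
                     (valid _ (hypercubeSystem-isHypercube LocalState base))

  EDI-complete : ∀ {m φ} → (∀ F → IsEDI F → ValidOn F φ) → ⊢_ {suc (suc m)} φ
  EDI-complete valid = classical λ ⊬φ →
    let Γ₀ , m~φ = refutable ⊬φ
        open CanonicalModel Γ₀
    in Truth.refutes (productFrame-presentation LocalState base) m~φ
                     (valid _ (productFrame-isEDI LocalState base))

corollary4p1 : ExcludedMiddle 0ℓ → (n : ℕ) → 2 ≤ n →
    SoundCompleteSystems n IsFull
    × SoundCompleteSystems n IsHypercube
    × SoundCompleteFrames n IsEDI
    × SoundCompleteFrames n IsED
corollary4p1 lem (suc (suc m)) (s≤s (s≤s z≤n)) =
    (λ φ → mk⇔ (λ ⊢φ Sys → ED-sound ⊢φ ∘ full⇒ED Sys)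
               (λ valid → hypercube-complete (λ Sys → valid Sys ∘ hypercube⇒full Sys)))
  , (λ φ → mk⇔ (λ ⊢φ Sys → ED-sound ⊢φ ∘ full⇒ED Sys ∘ hypercube⇒full Sys)
               hypercube-complete)
  , (λ φ → mk⇔ (λ ⊢φ F → ED-sound ⊢φ ∘ EDI⇒ED F)
               EDI-complete)
  , (λ φ → mk⇔ (λ ⊢φ F → ED-sound ⊢φ)
               (λ valid → EDI-complete (λ F → valid F ∘ EDI⇒ED F)))
  where open Classical lem
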